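{- Let $p\ge 2$ be an integer, let $0\le i\le 2^p-1$ have binary digits $i=d_{p-1}2^{p-1}+\cdots+d_0$, and define $E_p(i,n)=d_{p-1-v_p(n)}$ for $n\ge 0$ (so that $w_i(n)=(-1)^{E_p(i,n)}$). Then for every integer $n\ge0$ and every $0\le r<p$, \[ E_p(i,pn+r)=\begin{cases} d_{p-1-v_p(n)-r}, & \text{if } v_p(n)+r<p,\\ d_{p-1-s}, & \text{if } v_p(n)+r\ge p,\end{cases} \] where $s=v_p(n)+r-p$. Moreover, \[ E_p(i,pn+r)-E_p(i,n)\equiv E_p(x_r(i),n)\pmod 2 . \]
   Context: For an integer $n\ge0$, $v_p(n)\in\{0,\dots,p-1\}$ denotes the sum of the base-$p$ digits of $n$ reduced modulo $p$. For $0\le i\le 2^p-1$ with binary digits $d_{p-1},\dots,d_0$ and $0\le r<p$, the degree-$p$ xor-shift of $i$ by $r$ is $x_r(i)=e_{p-1}2^{p-1}+\cdots+e_0$, where $e_k=d_k\oplus d_{k-r}$ if $k\ge r$ and $e_k=d_k\oplus d_{k+(p-r)}$ if $k<r$ (here $\oplus$ is XOR on bits); equivalently, $x_r(i)$ is the bitwise XOR of $i$ with the cyclic left rotation by $r$ positions of its $p$-bit representation. $E_p(x_r(i),n)$ denotes the binary digit of $x_r(i)$ in position $p-1-v_p(n)$. -}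

module Defs where

open import Data.Nat using (ℕ; zero; suc; _+_; _*_; _∸_; _^_; _≤ᵇ_)
open import Data.Nat.DivMod using (_/_; _%_)
open import Data.Bool using (if_then_else_)

-- Sum of base-p digits of n, with fuel (fuel n suffices when p ≥ 2).
digitSumFuel : ℕ → ℕ → ℕ → ℕ
digitSumFuel zero    p       n = 0
digitSumFuel (suc f) zero    n = 0
digitSumFuel (suc f) (suc q) n = n % suc q + digitSumFuel f (suc q) (n / suc q)

digitSum : ℕ → ℕ → ℕ
digitSum p n = digitSumFuel n p n

-- v_p(n): sum of base-p digits of n reduced modulo p (junk 0 for p = 0).
v : ℕ → ℕ → ℕ
v zero    n = 0
v (suc q) n = digitSum (suc q) n % suc q

bit : ℕ → ℕ → ℕ
bit i zero    = i % 2
bit i (suc k) = bit (i / 2) k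

E : ℕ → ℕ → ℕ → ℕ
E p i n = bit i (p ∸ 1 ∸ v p n)

xorBit : ℕ → ℕ → ℕ
xorBit a b = (a + b) % 2

fromBits : ℕ → (ℕ → ℕ) → ℕ
fromBits zero    f = 0
fromBits (suc m) f = fromBits m f + f m * 2 ^ m

xshift : ℕ → ℕ → ℕ → ℕ
xshift p r i = fromBits p (λ k → xorBit (bit i k)
                 (bit i (if r ≤ᵇ k then k ∸ r else k + (p ∸ r))))

{-# OPTIONS --safe #-}
-- Adding r < p to n's base-p expansion in the lowest place (n ↦ p n + r) adds r
-- to its digit sum, so v_p(p n + r) = (v_p(n) + r) mod p.  Reading bits from the
-- top, position p-1-((v+r) mod p) is position p-1-v rotated down by r, so the
-- bit selected by p n + r is the rotated bit of i, while x_r(i) at position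
-- p-1-v is that rotated bit XOR the bit selected by n.
module Submission where

open import Defs
open import Data.Nat using (ℕ; _+_; _*_; _∸_; _^_; _≤_; _<_)
open import Data.Product using (_×_)
open import Relation.Binary.PropositionalEquality using (_≡_)
open import Data.Integer using (+_; _-_)
open import Data.Integer.Divisibility using (_∣_)

open import Data.Nat using (zero; suc; s≤s; s≤s⁻¹; _≤ᵇ_; _≤?_; NonZero)
open import Data.Nat.Properties
open import Data.Nat.DivMod
open import Data.Nat.Solver using (module +-*-Solver)
open import Data.Bool using (true; false; if_then_else_)
open import Data.Product using (_,_)
open import Data.Empty using (⊥-elim)
open import Relation.Nullary using (yes; no)
open import Relation.Nullary.Reflects using (ofʸ; ofⁿ)
open import Relation.Binary.PropositionalEquality
  using (refl; sym; trans; cong; cong₂; subst₂; module ≡-Reasoning)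
import Data.Nat.Divisibility as ℕ

open ≡-Reasoning

private
  variable
    d f g k m n p r : ℕ

[m+n*d]%d≡m : ∀ n .{{_ : NonZero d}} → m < d → (m + n * d) % d ≡ m
[m+n*d]%d≡m {d} {m} n m<d = trans ([m+kn]%n≡m%n m n d) (m<n⇒m%n≡m m<d)

[m+n*d]/d≡n : ∀ n .{{_ : NonZero d}} → m < d → (m + n * d) / d ≡ n
[m+n*d]/d≡n {d} {m} n m<d = begin
  (m + n * d) / d     ≡⟨ +-distrib-/-∣ʳ m (ℕ.n∣m*n n) ⟩
  m / d + n * d / d   ≡⟨ cong₂ _+_ (m<n⇒m/n≡0 m<d) (m*n/n≡m n d) ⟩
  n                   ∎

n≤m<n+n⇒m%n≡m∸n : .{{_ : NonZero n}} → n ≤ m → m < n + n → m % n ≡ m ∸ n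
n≤m<n+n⇒m%n≡m∸n {n} {m} n≤m m<2n =
  trans (sym (m≤n⇒[n∸m]%m≡n%m n≤m)) (m<n⇒m%n≡m (m<n+o⇒m∸n<o m n m<2n))

m∸n+[n∸o]≡m∸o : ∀ {o} → o ≤ n → n ≤ m → (m ∸ n) + (n ∸ o) ≡ m ∸ o
m∸n+[n∸o]≡m∸o {n} {m} {o} o≤n n≤m = begin
  (m ∸ n) + (n ∸ o)   ≡⟨ +-∸-assoc (m ∸ n) o≤n ⟨
  (m ∸ n) + n ∸ o     ≡⟨ cong (_∸ o) (m∸n+n≡m n≤m) ⟩
  m ∸ o               ∎

digitSumFuel-0 : ∀ f q → digitSumFuel f (suc (suc q)) 0 ≡ 0
digitSumFuel-0 zero    q = refl
digitSumFuel-0 (suc f) q = digitSumFuel-0 f q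

digitSumFuel-irrelevant : 1 < p → n ≤ f → n ≤ g →
                          digitSumFuel f p n ≡ digitSumFuel g p n
digitSumFuel-irrelevant {suc (suc q)} {zero} {f} {g} (s≤s (s≤s _)) _ _ =
  trans (digitSumFuel-0 f q) (sym (digitSumFuel-0 g q))
digitSumFuel-irrelevant {p@(suc (suc _))} {suc n} {suc f} {suc g}
                        1<p@(s≤s (s≤s _)) (s≤s n≤f) (s≤s n≤g) =
  cong (λ x → suc n % p + x) (digitSumFuel-irrelevant 1<p (quotient≤ n≤f) (quotient≤ n≤g))
  where
  quotient≤ : ∀ {h} → n ≤ h → suc n / p ≤ h
  quotient≤ n≤h = ≤-trans (s≤s⁻¹ (m/n<m (suc n) p 1<p)) n≤h

digitSum-lowDigit : 1 < p → r < p → digitSum p (r + n * p) ≡ r + digitSum p n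
digitSum-lowDigit {p@(suc (suc _))} {r} {n} 1<p@(s≤s (s≤s _)) r<p = begin
  digitSumFuel N p N                  ≡⟨ digitSumFuel-irrelevant 1<p ≤-refl (n≤1+n N) ⟩
  digitSumFuel (suc N) p N            ≡⟨⟩
  N % p + digitSumFuel N p (N / p)    ≡⟨ cong₂ _+_ ([m+n*d]%d≡m n r<p)
                                                    (cong (digitSumFuel N p) ([m+n*d]/d≡n n r<p)) ⟩
  r + digitSumFuel N p n              ≡⟨ cong (_+_ r) (digitSumFuel-irrelevant 1<p n≤N ≤-refl) ⟩
  r + digitSumFuel n p n              ∎
  where
  N = r + n * p
  n≤N : n ≤ N
  n≤N = ≤-trans (m≤m*n n p) (m≤n+m (n * p) r)

v<p : ∀ n → .{{_ : NonZero p}} → v p n < p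
v<p {suc q} n = m%n<n (digitSum (suc q) n) (suc q)

v-lowDigit : .{{_ : NonZero p}} → 1 < p → r < p → v p (p * n + r) ≡ (v p n + r) % p
v-lowDigit {p@(suc (suc _))} {r} {n} 1<p@(s≤s (s≤s _)) r<p = begin
  digitSum p (p * n + r) % p        ≡⟨ cong (λ x → digitSum p x % p)
                                              (trans (+-comm (p * n) r) (cong (_+_ r) (*-comm p n))) ⟩
  digitSum p (r + n * p) % p        ≡⟨ cong (_% p) (trans (digitSum-lowDigit {n = n} 1<p r<p) (+-comm r _)) ⟩
  (digitSum p n + r) % p            ≡⟨ %-distribˡ-+ (digitSum p n) r p ⟩
  (S % p + r % p) % p               ≡⟨ cong (λ x → (x + r % p) % p) (m%n%n≡m%n S p) ⟨
  (S % p % p + r % p) % p           ≡⟨ %-distribˡ-+ (S % p) r p ⟨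
  (S % p + r) % p                   ∎
  where
  S = digitSum p n

bit<2 : ∀ i k → bit i k < 2
bit<2 i zero    = m%n<n i 2
bit<2 i (suc k) = bit<2 (i / 2) k

fromBits-suc : ∀ m (b : ℕ → ℕ) → fromBits (suc m) b ≡ b 0 + fromBits m (λ j → b (suc j)) * 2
fromBits-suc zero    b = solve 1 (λ x → con 0 :+ x :* con 1 := x :+ con 0 :* con 2) refl (b 0)
  where open +-*-Solver
fromBits-suc (suc m) b = begin
  fromBits (suc m) b + b (suc m) * 2 ^ suc m                 ≡⟨ cong (_+ b (suc m) * 2 ^ suc m) (fromBits-suc m b) ⟩
  b 0 + X * 2 + b (suc m) * (2 * 2 ^ m)                      ≡⟨ shift (b 0) X (b (suc m)) (2 ^ m) ⟩
  b 0 + (X + b (suc m) * 2 ^ m) * 2                          ∎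
  where
  X = fromBits m (λ j → b (suc j))
  open +-*-Solver
  shift : ∀ x y c e → x + y * 2 + c * (2 * e) ≡ x + (y + c * e) * 2
  shift = solve 4 (λ x y c e → x :+ y :* con 2 :+ c :* (con 2 :* e)
                             := x :+ (y :+ c :* e) :* con 2) refl

bit-fromBits : ∀ m (b : ℕ → ℕ) → (∀ j → b j < 2) → k < m → bit (fromBits m b) k ≡ b k
bit-fromBits {zero}  (suc m) b b<2 _ rewrite fromBits-suc m b = [m+n*d]%d≡m X (b<2 0)
  where X = fromBits m (λ j → b (suc j))
bit-fromBits {suc k} (suc m) b b<2 (s≤s k<m) rewrite fromBits-suc m b = begin
  bit ((b 0 + X * 2) / 2) k   ≡⟨ cong (λ x → bit x k) ([m+n*d]/d≡n X (b<2 0)) ⟩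
  bit X k                     ≡⟨ bit-fromBits m (λ j → b (suc j)) (λ j → b<2 (suc j)) k<m ⟩
  b (suc k)                   ∎
  where X = fromBits m (λ j → b (suc j))

xorBit-parity : ∀ {b c} → b < 2 → c < 2 → (+ 2) ∣ ((+ c - + b) - + xorBit b c)
xorBit-parity {0} {0} _ _ = ℕ.divides 0 refl
xorBit-parity {0} {1} _ _ = ℕ.divides 0 refl
xorBit-parity {1} {0} _ _ = ℕ.divides 1 refl
xorBit-parity {1} {1} _ _ = ℕ.divides 0 refl
xorBit-parity {suc (suc _)} (s≤s (s≤s ()))
xorBit-parity {0} {suc (suc _)} _ (s≤s (s≤s ()))
xorBit-parity {1} {suc (suc _)} _ (s≤s (s≤s ()))

rotateIndex : ℕ → ℕ → ℕ → ℕ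
rotateIndex p r k = if r ≤ᵇ k then k ∸ r else k + (p ∸ r)

rotateIndex-≤ : r ≤ k → rotateIndex p r k ≡ k ∸ r
rotateIndex-≤ {r} {k} r≤k with r ≤ᵇ k | ≤ᵇ-reflects-≤ r k
... | true  | ofʸ _   = refl
... | false | ofⁿ r≰k = ⊥-elim (r≰k r≤k)

rotateIndex-> : k < r → rotateIndex p r k ≡ k + (p ∸ r)
rotateIndex-> {k} {r} k<r with r ≤ᵇ k | ≤ᵇ-reflects-≤ r k
... | true  | ofʸ r≤k = ⊥-elim (<⇒≱ k<r r≤k)
... | false | ofⁿ _   = refl

bit-xshift : ∀ i r → k < p → bit (xshift p r i) k ≡ xorBit (bit i k) (bit i (rotateIndex p r k))
bit-xshift {k} {p} i r =
  bit-fromBits p (λ j → xorBit (bit i j) (bit i (rotateIndex p r j)))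
                 (λ j → m%n<n (bit i j + bit i (rotateIndex p r j)) 2)

reflect-+%≡rotateIndex : ∀ {a} → .{{_ : NonZero p}} → a < p → r < p →
                         p ∸ 1 ∸ (a + r) % p ≡ rotateIndex p r (p ∸ 1 ∸ a)
reflect-+%≡rotateIndex {p@(suc q)} {r} {a} (s≤s a≤q) r<p with r ≤? q ∸ a
... | yes r≤pos = begin
  q ∸ (a + r) % p         ≡⟨ cong (q ∸_) (m<n⇒m%n≡m (s≤s a+r≤q)) ⟩
  q ∸ (a + r)             ≡⟨ ∸-+-assoc q a r ⟨
  q ∸ a ∸ r               ≡⟨ rotateIndex-≤ r≤pos ⟨
  rotateIndex p r (q ∸ a) ∎
  where
  a+r≤q : a + r ≤ q
  a+r≤q = subst₂ _≤_ refl (m+[n∸m]≡n a≤q) (+-monoʳ-≤ a r≤pos)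
... | no r≰pos = begin
  q ∸ (a + r) % p     ≡⟨ cong (q ∸_) (n≤m<n+n⇒m%n≡m∸n p≤a+r (+-mono-< (s≤s a≤q) r<p)) ⟩
  q ∸ s               ≡⟨ cong (_∸ s) pos+t+s≡q ⟨
  pos + t + s ∸ s     ≡⟨ m+n∸n≡m (pos + t) s ⟩
  pos + t             ≡⟨ rotateIndex-> (≰⇒> r≰pos) ⟨
  rotateIndex p r pos ∎
  where
  pos = q ∸ a
  t = p ∸ r
  s = a + r ∸ p
  p≤a+r : p ≤ a + r
  p≤a+r = subst₂ _≤_ (trans (+-suc a pos) (cong suc (m+[n∸m]≡n a≤q))) refl
                     (+-monoʳ-≤ a (≰⇒> r≰pos))
  pos+t+s≡q : pos + t + s ≡ q
  pos+t+s≡q = begin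
    pos + t + s         ≡⟨ +-assoc pos t s ⟩
    pos + (t + s)       ≡⟨ cong (_+_ pos) (+-comm t s) ⟩
    pos + (s + t)       ≡⟨ cong (_+_ pos) (m∸n+[n∸o]≡m∸o (<⇒≤ r<p) p≤a+r) ⟩
    pos + (a + r ∸ r)   ≡⟨ cong (_+_ pos) (m+n∸n≡m a r) ⟩
    pos + a             ≡⟨ m∸n+n≡m a≤q ⟩
    q                   ∎

E-lowDigit : ∀ i n → .{{_ : NonZero p}} → 1 < p → r < p →
             E p i (p * n + r) ≡ bit i (p ∸ 1 ∸ (v p n + r) % p)
E-lowDigit {p} i n 1<p r<p = cong (λ x → bit i (p ∸ 1 ∸ x)) (v-lowDigit {n = n} 1<p r<p)

mainTheorem8 : (p i n r : ℕ) → 2 ≤ p → i < 2 ^ p → r < p →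
    ((v p n + r < p → E p i (p * n + r) ≡ bit i (p ∸ 1 ∸ (v p n + r)))
    × (p ≤ v p n + r → E p i (p * n + r) ≡ bit i (p ∸ 1 ∸ (v p n + r ∸ p))))
    × ((+ 2) ∣ ((+ E p i (p * n + r) - + E p i n) - + E p (xshift p r i) n))
mainTheorem8 p@(suc (suc _)) i n r 1<p@(s≤s (s≤s _)) _ r<p = (noWrap , wrap) , parity
  where
  noWrap : v p n + r < p → E p i (p * n + r) ≡ bit i (p ∸ 1 ∸ (v p n + r))
  noWrap lt = trans (E-lowDigit i n 1<p r<p) (cong (λ x → bit i (p ∸ 1 ∸ x)) (m<n⇒m%n≡m lt))
  wrap : p ≤ v p n + r → E p i (p * n + r) ≡ bit i (p ∸ 1 ∸ (v p n + r ∸ p))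
  wrap le = trans (E-lowDigit i n 1<p r<p)
    (cong (λ x → bit i (p ∸ 1 ∸ x)) (n≤m<n+n⇒m%n≡m∸n le (+-mono-< (v<p n) r<p)))
  pos = p ∸ 1 ∸ v p n
  parity : (+ 2) ∣ ((+ E p i (p * n + r) - + E p i n) - + E p (xshift p r i) n)
  parity = subst₂ (λ x y → (+ 2) ∣ ((+ x - + bit i pos) - + y))
    (sym (trans (E-lowDigit i n 1<p r<p) (cong (bit i) (reflect-+%≡rotateIndex (v<p n) r<p))))
    (sym (bit-xshift i r (s≤s (m∸n≤m _ (v p n)))))
    (xorBit-parity (bit<2 i pos) (bit<2 i (rotateIndex p r pos)))
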